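{- Let $\alpha\in\mathcal O$ (a notation for a genuine computable ordinal), let $\mathcal P,\mathcal N$ be countable sets of $\alpha$-ranked labeled Borel codes, and let $T$ be a labeled Borel code $\alpha$-ranked by some $\rho$. Let $X\in 2^\omega$ be such that $X\notin|Q|$ for every $Q\in\mathcal P\cup\mathcal N$ of rank $<_\ast\alpha$. Then $X\in|\mathrm{Decorate}(T,\mathcal P,\mathcal N)|$ if and only if $X\in|T|$.
   Context: $\mathcal O^\ast$ is the set of ordinal notations in $\mathrm{HYP}$ (the $\omega$-model of hyperarithmetic sets) with the computable order $<_\ast$, and $\mathcal O\subseteq\mathcal O^\ast$ the notations with no $<_\ast$-descending sequence below them. A labeled Borel code is a tree $T\subseteq\omega^{<\omega}$ with labeling: interior nodes labeled $\bigcup$ (union node) or $\bigcap$ (intersection node), leaves labeled with codes of clopen subsets of $2^\omega$. For $\alpha\in\mathcal O^\ast$, $T$ is $\alpha$-ranked by $\rho:T\to\{\beta\in\mathcal O^\ast:\beta\le_\ast\alpha\}$ if $\rho(\sigma^\frown n)<_\ast\rho(\sigma)$ whenever $\sigma^\frown n\in T$; the rank of $T$ is $\rho(\langle\rangle)$. For $X\in2^\omega$, an evaluation map for $X$ in $T$ is $f:T\to\{0,1\}$ with $f(\eta)=1$ iff $X\in\ell(\eta)$ at leaves, $f(\sigma)=1$ iff some child has value 1 at union nodes, $f(\sigma)=1$ iff all children have value 1 at intersection nodes; $X\in|T|$ means there is an evaluation map with $f(\langle\rangle)=1$. $\neg T$ is the code on the same tree with $\bigcup,\bigcap$ swapped and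 each leaf's clopen set replaced by its complement. $T_n=\{\sigma:\langle n\rangle^\frown\sigma\in T\}$. The decoration $\mathrm{Decorate}(T,\mathcal P,\mathcal N)$ is defined recursively: if $T$ is a leaf it is $T$; otherwise the root keeps its label and its children are: $\mathrm{Decorate}(T_n,\mathcal P,\mathcal N)$ for each child $T_n$ of $T$; if the root is a union node, $\mathrm{Decorate}(P,\mathcal P,\mathcal N)$ for each $P\in\mathcal P$ of rank $<_\ast\rho(\langle\rangle)$; if the root is an intersection node, $\mathrm{Decorate}(\neg N,\mathcal P,\mathcal N)$ for each $N\in\mathcal N$ of rank $<_\ast\rho(\langle\rangle)$. -}

module Defs where

open import Level using (0ℓ)
open import Data.Nat using (ℕ; zero; suc)
open import Data.Bool using (Bool; true; false; not; _∧_)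
open import Data.Fin using (toℕ)
open import Data.List using (List; []; _∷_; [_]; _++_)
open import Data.Maybe using (Maybe; just; nothing; is-just)
open import Data.Vec using (Vec; tabulate)
open import Data.Product using (Σ; _×_; _,_; ∃; ∃-syntax)
open import Data.Sum using (_⊎_)
open import Relation.Binary.Core using (Rel)
open import Relation.Binary.Definitions using (Decidable)
open import Relation.Binary.Structures using (IsStrictPartialOrder)
open import Relation.Binary.PropositionalEquality using (_≡_)
open import Relation.Nullary using (¬_; does)
open import Function.Bundles using (_⇔_)

Cantor : Set
Cantor = ℕ → Bool

-- A code of a clopen subset of 2^ω: a length n and a truth table on the
-- first n bits.  (Every clopen set depends on finitely many bits.)
record Clopen : Set where
  constructor clopen
  field
    len   : ℕ
    table : Vec Bool len → Bool

restrict : Cantor → (n : ℕ) → Vec Bool n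
restrict X n = tabulate (λ i → X (toℕ i))

_∈ᶜ_ : Cantor → Clopen → Set
X ∈ᶜ clopen n t = t (restrict X n) ≡ true

complementᶜ : Clopen → Clopen
complementᶜ (clopen n t) = clopen n (λ s → not (t s))

data Label : Set where
  ⋃ᴸ    : Label
  ⋂ᴸ    : Label
  leafᴸ : Clopen → Label

isUnion : Label → Bool
isUnion ⋃ᴸ = true
isUnion _  = false

isInter : Label → Bool
isInter ⋂ᴸ = true
isInter _  = false

swapLabel : Label → Label
swapLabel ⋃ᴸ        = ⋂ᴸ
swapLabel ⋂ᴸ        = ⋃ᴸ
swapLabel (leafᴸ c) = leafᴸ (complementᶜ c)

-- Sequences in ω^{<ω} are lists of naturals;
-- σ⌢n is σ ++ [ n ].  The tree is a (characteristic function of a)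
-- subset of ω^{<ω}; the labelling is only meaningful on the tree.

record LTree : Set where
  field
    tree  : List ℕ → Bool
    label : List ℕ → Label

open LTree public

_∈ᵀ_ : List ℕ → LTree → Set
σ ∈ᵀ T = tree T σ ≡ true

record IsLabeledBorelCode (T : LTree) : Set where
  field
    root∈    : [] ∈ᵀ T
    prefix   : ∀ σ n → (σ ++ [ n ]) ∈ᵀ T → σ ∈ᵀ T
    leaf-iff : ∀ σ → σ ∈ᵀ T →
               (∃[ c ] label T σ ≡ leafᴸ c) ⇔ (∀ n → tree T (σ ++ [ n ]) ≡ false)

negᵀ : LTree → LTree
negᵀ T = record { tree = tree T ; label = λ σ → swapLabel (label T σ) }

subᵀ : LTree → ℕ → LTree
subᵀ T n = record { tree = λ σ → tree T (n ∷ σ) ; label = λ σ → label T (n ∷ σ) }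

record EvaluationMap (X : Cantor) (T : LTree) (f : List ℕ → Bool) : Set where
  field
    at-leaf  : ∀ σ → σ ∈ᵀ T → ∀ c → label T σ ≡ leafᴸ c →
               (f σ ≡ true ⇔ X ∈ᶜ c)
    at-union : ∀ σ → σ ∈ᵀ T → label T σ ≡ ⋃ᴸ →
               (f σ ≡ true ⇔ (∃[ n ] ((σ ++ [ n ]) ∈ᵀ T × f (σ ++ [ n ]) ≡ true)))
    at-inter : ∀ σ → σ ∈ᵀ T → label T σ ≡ ⋂ᴸ →
               (f σ ≡ true ⇔ (∀ n → (σ ++ [ n ]) ∈ᵀ T → f (σ ++ [ n ]) ≡ true))

_∈⟦_⟧ : Cantor → LTree → Set
X ∈⟦ T ⟧ = ∃[ f ] (EvaluationMap X T f × f [] ≡ true)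

record NotationSystem : Set₁ where
  field
    Not        : Set
    _<*_       : Rel Not 0ℓ
    isSPO      : IsStrictPartialOrder _≡_ _<*_
    _<*?_      : Decidable _<*_

module _ (𝒪 : NotationSystem) where
  open NotationSystem 𝒪

  _≤*_ : Rel Not 0ℓ
  β ≤* α = β <* α ⊎ β ≡ α

  InO : Not → Set
  InO α = ¬ (Σ (ℕ → Not) λ s → s 0 <* α × (∀ n → s (suc n) <* s n))

  IsRanking : Not → LTree → (List ℕ → Not) → Set
  IsRanking α T ρ = (∀ σ → σ ∈ᵀ T → ρ σ ≤* α)
                  × (∀ σ n → (σ ++ [ n ]) ∈ᵀ T → ρ (σ ++ [ n ]) <* ρ σ)

  record RCode : Set where
    constructor _,ρ_
    field
      codeᴿ : LTree
      rkᴿ   : List ℕ → Not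

  open RCode public

  rankᴿ : RCode → Not
  rankᴿ C = rkᴿ C []

  IsRankedCode : Not → RCode → Set
  IsRankedCode α C = IsLabeledBorelCode (codeᴿ C) × IsRanking α (codeᴿ C) (rkᴿ C)

  -- countable sets of ranked codes, enumerated with possible gaps
  CSet : Set
  CSet = ℕ → Maybe RCode

  _∈ˢ_ : RCode → CSet → Set
  Q ∈ˢ 𝒫 = ∃[ k ] 𝒫 k ≡ just Q

  negᴿ : RCode → RCode
  negᴿ (T ,ρ ρ) = negᵀ T ,ρ ρ

  subᴿ : RCode → ℕ → RCode
  subᴿ (T ,ρ ρ) n = subᵀ T n ,ρ (λ σ → ρ (n ∷ σ))

  -- Child indices of a decorated node are coded:
  --   3k   ↦ Decorate(T_k)            (if ⟨k⟩ ∈ T)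
  --   3k+1 ↦ Decorate(P)   for 𝒫 k = just P (root union, rank P <* ρ⟨⟩)
  --   3k+2 ↦ Decorate(¬N)  for 𝒩 k = just N (root inter, rank N <* ρ⟨⟩)

  data Tag : Set where
    tagT tagP tagN : Tag

  decode3 : ℕ → Tag × ℕ
  decode3 0 = tagT , 0
  decode3 1 = tagP , 0
  decode3 2 = tagN , 0
  decode3 (suc (suc (suc i))) with decode3 i
  ... | t , k = t , suc k

  module _ (𝒫 𝒩 : CSet) where

    -- the (undecorated) code whose decoration sits at child i of Decorate(C)
    childD : RCode → ℕ → Maybe RCode
    childD C i with label (codeᴿ C) [] | decode3 i
    ... | leafᴸ _ | _      = nothing
    ... | ℓ       | tagT , k with tree (codeᴿ C) [ k ]
    ...   | true  = just (subᴿ C k)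
    ...   | false = nothing
    childD C i | ℓ | tagP , k with isUnion ℓ | 𝒫 k
    ...   | true | just P with does (rankᴿ P <*? rankᴿ C)
    ...     | true  = just P
    ...     | false = nothing
    childD C i | ℓ | tagP , k | _ | _ = nothing
    childD C i | ℓ | tagN , k with isInter ℓ | 𝒩 k
    ...   | true | just N with does (rankᴿ N <*? rankᴿ C)
    ...     | true  = just (negᴿ N)
    ...     | false = nothing
    childD C i | ℓ | tagN , k | _ | _ = nothing

    nav : RCode → List ℕ → Maybe RCode
    nav C []      = just C
    nav C (i ∷ σ) with childD C i
    ... | just D  = nav D σ
    ... | nothing = nothing

    labelAt : Maybe RCode → Label
    labelAt (just D) = label (codeᴿ D) []
    labelAt nothing  = ⋃ᴸ   -- off the tree; irrelevant

    Decorate : RCode → LTree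
    Decorate C = record
      { tree  = λ σ → is-just (nav C σ)
      ; label = λ σ → labelAt (nav C σ)
      }

-- Evaluating a code at X amounts to checking the condition of its root label against the
-- membership of X in the immediate subcodes; with excluded middle this characterisation holds
-- for every well-founded tree, and ranked codes below a genuine ordinal are well-founded.
-- Decorate(T) has the same root label as T, its original children are decorations of the
-- children of T, and by induction on the rank these have the same members as the children.
-- The extra children of a union node are decorations of codes P of rank below α, which X
-- avoids, so they do not change the union; those of an intersection node are decorations
-- of ¬N with X ∉ |N|, so X belongs to them and they do not change the intersection.
module Submission where

open import Level using (0ℓ)
open import Data.Nat using (ℕ; zero; suc)
open import Data.Bool using (Bool; true; false; not)
open import Data.Bool.Properties using (¬-not)
open import Data.List using (List; []; _∷_; [_]; _++_)
open import Data.List.Properties using (++-identityʳ; ++-assoc)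
open import Data.Maybe using (Maybe; just; nothing; is-just; _>>=_)
open import Data.Product using (Σ-syntax; _×_; _,_; ∃-syntax; proj₁; proj₂)
open import Data.Sum using (_⊎_; inj₁; inj₂)
open import Data.Empty using (⊥-elim)
open import Relation.Binary.PropositionalEquality using (_≡_; _≢_; refl; sym; trans; subst; cong)
open import Relation.Binary.Structures using (IsStrictPartialOrder)
open import Relation.Nullary using (¬_; Dec; yes; no; does)
open import Relation.Nullary.Decidable using (decidable-stable)
open import Function.Base using (_∘_; id)
open import Function.Bundles using (_⇔_; mk⇔; Equivalence)
import Function.Properties.Equivalence as ⇔
open import Axiom.ExcludedMiddle using (ExcludedMiddle)
open import Induction.WellFounded using (Acc; acc; acc-inverse)
open import Defs

open Equivalence using (to; from)

variable
  X : Cantor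
  T T' : LTree
  f : List ℕ → Bool
  σ : List ℕ
  Child Child' Holds Holds' : ℕ → Set

does≡true⇔ : {P : Set} (P? : Dec P) → does P? ≡ true ⇔ P
does≡true⇔ (yes p) = mk⇔ (λ _ → p) (λ _ → refl)
does≡true⇔ (no ¬p) = mk⇔ (λ ()) (λ p → ⊥-elim (¬p p))

not≡true⇔¬ : ∀ {b} → not b ≡ true ⇔ (¬ b ≡ true)
not≡true⇔¬ {true}  = mk⇔ (λ ()) (λ b≢true → ⊥-elim (b≢true refl))
not≡true⇔¬ {false} = mk⇔ (λ _ ()) (λ _ → refl)

¬-cong : {A B : Set} → A ⇔ B → (¬ A) ⇔ (¬ B)
¬-cong A⇔B = mk⇔ (λ ¬a b → ¬a (from A⇔B b)) (λ ¬b a → ¬b (to A⇔B a))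

true≢false : true ≢ false
true≢false ()

⋃≢⋂ : ⋃ᴸ ≢ ⋂ᴸ
⋃≢⋂ ()

-- Child n: the n-th child exists; Holds n: it evaluates to true.
NodeCondition : Label → Cantor → (ℕ → Set) → (ℕ → Set) → Set
NodeCondition (leafᴸ c) X Child Holds = X ∈ᶜ c
NodeCondition ⋃ᴸ        X Child Holds = ∃[ n ] (Child n × Holds n)
NodeCondition ⋂ᴸ        X Child Holds = ∀ n → Child n → Holds n

NodeCondition-map : ∀ ℓ → (∀ {n} → Child n ⇔ Child' n) → (∀ {n} → Holds n → Holds' n) →
                    NodeCondition ℓ X Child Holds → NodeCondition ℓ X Child' Holds'
NodeCondition-map (leafᴸ c) Child⇔ Holds⇒ x           = x
NodeCondition-map ⋃ᴸ        Child⇔ Holds⇒ (n , c , h) = n , to Child⇔ c , Holds⇒ h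
NodeCondition-map ⋂ᴸ        Child⇔ Holds⇒ all n c     = Holds⇒ (all n (from Child⇔ c))

NodeCondition-not : ExcludedMiddle 0ℓ → ∀ ℓ {g : ℕ → Bool} →
  NodeCondition (swapLabel ℓ) X Child (λ n → not (g n) ≡ true) ⇔
  (¬ NodeCondition ℓ X Child (λ n → g n ≡ true))
NodeCondition-not lem (leafᴸ (clopen _ _)) = not≡true⇔¬
NodeCondition-not lem ⋃ᴸ = mk⇔
  (λ all (n , c , h) → to not≡true⇔¬ (all n c) h)
  (λ ¬some n c → from not≡true⇔¬ (λ h → ¬some (n , c , h)))
NodeCondition-not lem ⋂ᴸ = mk⇔
  (λ (n , c , h) all → to not≡true⇔¬ h (all n c))
  (λ ¬all → decidable-stable lem λ ¬some →
     ¬all (λ n c → decidable-stable lem (λ h → ¬some (n , c , from not≡true⇔¬ h))))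

-- Pointwise form of EvaluationMap, uniform in the label.
Evaluates : Cantor → LTree → (List ℕ → Bool) → Set
Evaluates X T f = ∀ σ → σ ∈ᵀ T →
  f σ ≡ true ⇔ NodeCondition (label T σ) X (λ n → (σ ++ [ n ]) ∈ᵀ T) (λ n → f (σ ++ [ n ]) ≡ true)

EvaluationMap⇒Evaluates : EvaluationMap X T f → Evaluates X T f
EvaluationMap⇒Evaluates {T = T} M σ σ∈ with label T σ in eq
... | leafᴸ c = EvaluationMap.at-leaf  M σ σ∈ c eq
... | ⋃ᴸ      = EvaluationMap.at-union M σ σ∈ eq
... | ⋂ᴸ      = EvaluationMap.at-inter M σ σ∈ eq

Evaluates⇒EvaluationMap : Evaluates X T f → EvaluationMap X T f
Evaluates⇒EvaluationMap {X = X} {T = T} {f = f} ev = record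
  { at-leaf  = λ σ σ∈ c eq → subst (Condition σ) eq (ev σ σ∈)
  ; at-union = λ σ σ∈ eq → subst (Condition σ) eq (ev σ σ∈)
  ; at-inter = λ σ σ∈ eq → subst (Condition σ) eq (ev σ σ∈)
  }
  where
  Condition : List ℕ → Label → Set
  Condition σ ℓ =
    f σ ≡ true ⇔ NodeCondition ℓ X (λ n → (σ ++ [ n ]) ∈ᵀ T) (λ n → f (σ ++ [ n ]) ≡ true)

∈⟦⟧-intro : Evaluates X T f → f [] ≡ true → X ∈⟦ T ⟧
∈⟦⟧-intro ev f[]≡true = _ , Evaluates⇒EvaluationMap ev , f[]≡true

Evaluates-empty : (∀ σ → tree T σ ≡ false) → Evaluates X T f
Evaluates-empty none σ σ∈ = ⊥-elim (true≢false (trans (sym σ∈) (none σ)))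

withRoot : Bool → (ℕ → List ℕ → Bool) → List ℕ → Bool
withRoot b g []      = b
withRoot b g (n ∷ σ) = g n σ

Evaluates-withRoot : ∀ {b g} → (∀ n → Evaluates X (subᵀ T n) (g n)) →
  ([] ∈ᵀ T → b ≡ true ⇔ NodeCondition (label T []) X (λ n → [ n ] ∈ᵀ T) (λ n → g n [] ≡ true)) →
  Evaluates X T (withRoot b g)
Evaluates-withRoot children root []      = root
Evaluates-withRoot children root (n ∷ σ) = children n σ

Evaluates-neg : ExcludedMiddle 0ℓ → Evaluates X T f → Evaluates X (negᵀ T) (not ∘ f)
Evaluates-neg {T = T} lem ev σ σ∈ =
  ⇔.trans not≡true⇔¬ (⇔.trans (¬-cong (ev σ σ∈)) (⇔.sym (NodeCondition-not lem (label T σ))))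

_≈ᵀ_ : LTree → LTree → Set
T ≈ᵀ T' = (∀ σ → tree T σ ≡ tree T' σ) × (∀ σ → label T σ ≡ label T' σ)

≈ᵀ-sym : T ≈ᵀ T' → T' ≈ᵀ T
≈ᵀ-sym (same-tree , same-label) = sym ∘ same-tree , sym ∘ same-label

∈ᵀ-resp-≈ᵀ : T ≈ᵀ T' → σ ∈ᵀ T ⇔ σ ∈ᵀ T'
∈ᵀ-resp-≈ᵀ {σ = σ} (same-tree , _) = mk⇔ (trans (sym (same-tree σ))) (trans (same-tree σ))

Evaluates-resp-≈ᵀ : T ≈ᵀ T' → Evaluates X T f → Evaluates X T' f
Evaluates-resp-≈ᵀ {T = T} {T' = T'} {X = X} {f = f} T≈T' ev σ σ∈ =
  subst (λ ℓ → f σ ≡ true ⇔ NodeCondition ℓ X (λ n → (σ ++ [ n ]) ∈ᵀ T')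
                                               (λ n → f (σ ++ [ n ]) ≡ true))
        (proj₂ T≈T' σ)
        (⇔.trans (ev σ (from (∈ᵀ-resp-≈ᵀ T≈T') σ∈))
                 (mk⇔ (NodeCondition-map (label T σ) (∈ᵀ-resp-≈ᵀ T≈T') id)
                      (NodeCondition-map (label T σ) (⇔.sym (∈ᵀ-resp-≈ᵀ T≈T')) id)))

∈⟦⟧-resp-≈ᵀ : T ≈ᵀ T' → X ∈⟦ T ⟧ ⇔ X ∈⟦ T' ⟧
∈⟦⟧-resp-≈ᵀ T≈T' = mk⇔ (move T≈T') (move (≈ᵀ-sym T≈T'))
  where
  move : T ≈ᵀ T' → X ∈⟦ T ⟧ → X ∈⟦ T' ⟧
  move e (_ , M , f[]≡true) = ∈⟦⟧-intro (Evaluates-resp-≈ᵀ e (EvaluationMap⇒Evaluates M)) f[]≡true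

data WfTree : LTree → Set where
  empty : (∀ σ → tree T σ ≡ false) → WfTree T
  node  : (∀ n → WfTree (subᵀ T n)) → WfTree T

WfTree-resp-≈ᵀ : T ≈ᵀ T' → WfTree T → WfTree T'
WfTree-resp-≈ᵀ (same-tree , _) (empty none) = empty (λ σ → trans (sym (same-tree σ)) (none σ))
WfTree-resp-≈ᵀ (same-tree , same-label) (node children) =
  node (λ n → WfTree-resp-≈ᵀ (same-tree ∘ (n ∷_) , same-label ∘ (n ∷_)) (children n))

Evaluates-exists : ExcludedMiddle 0ℓ → ∀ X → WfTree T → Σ[ f ∈ (List ℕ → Bool) ] Evaluates X T f
Evaluates-exists lem X (empty none) = (λ _ → true) , Evaluates-empty none
Evaluates-exists {T = T} lem X (node children) =
  withRoot (does root?) g ,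
  Evaluates-withRoot (proj₂ ∘ child) (λ _ → does≡true⇔ root?)
  where
  child : ∀ n → Σ[ f ∈ (List ℕ → Bool) ] Evaluates X (subᵀ T n) f
  child n = Evaluates-exists lem X (children n)
  g : ℕ → List ℕ → Bool
  g = proj₁ ∘ child
  root? : Dec (NodeCondition (label T []) X (λ n → [ n ] ∈ᵀ T) (λ n → g n [] ≡ true))
  root? = lem

Evaluates-decisive : ExcludedMiddle 0ℓ → ∀ X → WfTree T →
  Σ[ f ∈ (List ℕ → Bool) ] (Evaluates X T f × (X ∈⟦ T ⟧ → f [] ≡ true))
Evaluates-decisive {T = T} lem X wf with lem {X ∈⟦ T ⟧}
... | yes (f , M , f[]≡true) = f , EvaluationMap⇒Evaluates M , λ _ → f[]≡true
... | no X∉T = let (f , ev) = Evaluates-exists lem X wf in f , ev , λ X∈T → ⊥-elim (X∉T X∈T)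

RootCondition : Cantor → LTree → Set
RootCondition X T = NodeCondition (label T []) X (λ n → [ n ] ∈ᵀ T) (λ n → X ∈⟦ subᵀ T n ⟧)

∈⟦⟧⇒RootCondition : [] ∈ᵀ T → X ∈⟦ T ⟧ → RootCondition X T
∈⟦⟧⇒RootCondition {T = T} root∈ (f , M , f[]≡true) =
  NodeCondition-map (label T []) ⇔.refl
    (λ {n} fn≡true → ∈⟦⟧-intro {f = f ∘ (n ∷_)} (ev ∘ (n ∷_)) fn≡true)
    (to (ev [] root∈) f[]≡true)
  where
  ev = EvaluationMap⇒Evaluates M

RootCondition⇒∈⟦⟧ : ExcludedMiddle 0ℓ → WfTree T → RootCondition X T → X ∈⟦ T ⟧
RootCondition⇒∈⟦⟧ lem (empty none) _ = ∈⟦⟧-intro {f = λ _ → true} (Evaluates-empty none) refl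
RootCondition⇒∈⟦⟧ {T = T} {X = X} lem (node children) root =
  ∈⟦⟧-intro (Evaluates-withRoot {b = true} (proj₁ ∘ proj₂ ∘ child)
              (λ _ → mk⇔ (λ _ → NodeCondition-map (label T []) ⇔.refl
                                  (λ {n} → proj₂ (proj₂ (child n))) root)
                         (λ _ → refl)))
            refl
  where
  child : ∀ n →
    Σ[ f ∈ (List ℕ → Bool) ] (Evaluates X (subᵀ T n) f × (X ∈⟦ subᵀ T n ⟧ → f [] ≡ true))
  child n = Evaluates-decisive lem X (children n)

∈⟦⟧⇔RootCondition : ExcludedMiddle 0ℓ → WfTree T → [] ∈ᵀ T → X ∈⟦ T ⟧ ⇔ RootCondition X T
∈⟦⟧⇔RootCondition lem wf root∈ = mk⇔ (∈⟦⟧⇒RootCondition root∈) (RootCondition⇒∈⟦⟧ lem wf)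

∉⇒∈⟦neg⟧ : ExcludedMiddle 0ℓ → WfTree T → ¬ X ∈⟦ T ⟧ → X ∈⟦ negᵀ T ⟧
∉⇒∈⟦neg⟧ {X = X} lem wf X∉T =
  let (f , ev) = Evaluates-exists lem X wf in
  ∈⟦⟧-intro (Evaluates-neg lem ev) (from not≡true⇔¬ (X∉T ∘ ∈⟦⟧-intro ev))

∈ᵀ-prefix : (∀ σ n → (σ ++ [ n ]) ∈ᵀ T → σ ∈ᵀ T) → ∀ σ τ → (σ ++ τ) ∈ᵀ T → σ ∈ᵀ T
∈ᵀ-prefix {T = T} prefix σ []      σ∈ = subst (_∈ᵀ T) (++-identityʳ σ) σ∈
∈ᵀ-prefix {T = T} prefix σ (n ∷ τ) σnτ∈ =
  prefix σ n (∈ᵀ-prefix {T = T} prefix (σ ++ [ n ]) τ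
                (subst (_∈ᵀ T) (sym (++-assoc σ [ n ] τ)) σnτ∈))

module Ordinals (𝒪 : NotationSystem) where
  open NotationSystem 𝒪

  <*-≤*-trans : ∀ {β γ δ} → β <* γ → _≤*_ 𝒪 γ δ → β <* δ
  <*-≤*-trans β<γ (inj₁ γ<δ) = IsStrictPartialOrder.trans isSPO β<γ γ<δ
  <*-≤*-trans β<γ (inj₂ refl) = β<γ

  Acc-≤* : ∀ {β γ} → Acc _<*_ γ → _≤*_ 𝒪 β γ → Acc _<*_ β
  Acc-≤* accγ (inj₁ β<γ) = acc-inverse accγ β<γ
  Acc-≤* accγ (inj₂ refl) = accγ

  ¬Acc⇒smaller¬Acc : ExcludedMiddle 0ℓ → ∀ {β} → ¬ Acc _<*_ β → ∃[ γ ] (γ <* β × ¬ Acc _<*_ γ)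
  ¬Acc⇒smaller¬Acc lem ¬accβ = decidable-stable lem λ ¬smaller →
    ¬accβ (acc λ {γ} γ<β → decidable-stable lem (λ ¬accγ → ¬smaller (γ , γ<β , ¬accγ)))

  descendingChain : ExcludedMiddle 0ℓ → ∀ {β} → ¬ Acc _<*_ β → ℕ → ∃[ γ ] ¬ Acc _<*_ γ
  descendingChain lem {β} ¬accβ zero = β , ¬accβ
  descendingChain lem ¬accβ (suc n) =
    let (γ , _ , ¬accγ) = ¬Acc⇒smaller¬Acc lem (proj₂ (descendingChain lem ¬accβ n)) in γ , ¬accγ

  InO⇒Acc : ExcludedMiddle 0ℓ → ∀ {α} → InO 𝒪 α → Acc _<*_ α
  InO⇒Acc lem α∈O = decidable-stable lem λ ¬accα →
    let (β , β<α , ¬accβ) = ¬Acc⇒smaller¬Acc lem ¬accα in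
    α∈O ( proj₁ ∘ descendingChain lem ¬accβ
        , β<α
        , λ n → proj₁ (proj₂ (¬Acc⇒smaller¬Acc lem (proj₂ (descendingChain lem ¬accβ n)))))

module RankedTrees (𝒪 : NotationSystem) (α : NotationSystem.Not 𝒪) where
  open NotationSystem 𝒪

  record IsRankedTree (C : RCode 𝒪) : Set where
    field
      root∈   : [] ∈ᵀ codeᴿ C
      prefix  : ∀ σ n → (σ ++ [ n ]) ∈ᵀ codeᴿ C → σ ∈ᵀ codeᴿ C
      ranking : IsRanking 𝒪 α (codeᴿ C) (rkᴿ C)

    rank≤α : _≤*_ 𝒪 (rankᴿ 𝒪 C) α
    rank≤α = proj₁ ranking [] root∈

    descending : ∀ σ n → (σ ++ [ n ]) ∈ᵀ codeᴿ C → rkᴿ C (σ ++ [ n ]) <* rkᴿ C σ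
    descending = proj₂ ranking

  open IsRankedTree public

  IsRankedCode⇒IsRankedTree : ∀ {C} → IsRankedCode 𝒪 α C → IsRankedTree C
  IsRankedCode⇒IsRankedTree (code , ranking) = record
    { root∈   = IsLabeledBorelCode.root∈ code
    ; prefix  = IsLabeledBorelCode.prefix code
    ; ranking = ranking
    }

  IsRankedTree-sub : ∀ {C k} → IsRankedTree C → [ k ] ∈ᵀ codeᴿ C → IsRankedTree (subᴿ 𝒪 C k)
  IsRankedTree-sub {k = k} r k∈ = record
    { root∈   = k∈
    ; prefix  = prefix r ∘ (k ∷_)
    ; ranking = proj₁ (ranking r) ∘ (k ∷_) , descending r ∘ (k ∷_)
    }

  IsRankedTree-neg : ∀ {C} → IsRankedTree C → IsRankedTree (negᴿ 𝒪 C)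
  IsRankedTree-neg r = record { root∈ = root∈ r ; prefix = prefix r ; ranking = ranking r }

  IsRankedTree⇒WfTree : ∀ {C} → IsRankedTree C → Acc _<*_ (rankᴿ 𝒪 C) → WfTree (codeᴿ C)
  IsRankedTree⇒WfTree {C} r (acc smaller) = node child
    where
    child : ∀ n → WfTree (subᵀ (codeᴿ C) n)
    child n with tree (codeᴿ C) [ n ] in n∈
    ... | true  = IsRankedTree⇒WfTree (IsRankedTree-sub r n∈) (smaller (descending r [] n n∈))
    ... | false = empty λ σ → ¬-not λ nσ∈ →
      true≢false (trans (sym (∈ᵀ-prefix {T = codeᴿ C} (prefix r) [ n ] σ nσ∈)) n∈)

module Decoration (𝒪 : NotationSystem) (𝒫 𝒩 : CSet 𝒪) where
  open NotationSystem 𝒪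

  child : RCode 𝒪 → ℕ → Maybe (RCode 𝒪)
  child = childD 𝒪 𝒫 𝒩

  decorate : RCode 𝒪 → LTree
  decorate = Decorate 𝒪 𝒫 𝒩

  data ChildView (C : RCode 𝒪) : RCode 𝒪 → Set where
    original : ∀ k → [ k ] ∈ᵀ codeᴿ C → ChildView C (subᴿ 𝒪 C k)
    positive : ∀ {P} → label (codeᴿ C) [] ≡ ⋃ᴸ → _∈ˢ_ 𝒪 P 𝒫 → rankᴿ 𝒪 P <* rankᴿ 𝒪 C →
               ChildView C P
    negative : ∀ {N} → label (codeᴿ C) [] ≡ ⋂ᴸ → _∈ˢ_ 𝒪 N 𝒩 → rankᴿ 𝒪 N <* rankᴿ 𝒪 C →
               ChildView C (negᴿ 𝒪 N)

  childView : ∀ C i {D} → child C i ≡ just D → ChildView C D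
  childView C i eq with label (codeᴿ C) [] in ℓ≡ | decode3 𝒪 i
  childView C i () | leafᴸ _ | _
  childView C i eq | ⋃ᴸ | tagT , k with tree (codeᴿ C) [ k ] in k∈
  childView C i refl | ⋃ᴸ | tagT , k | true = original k k∈
  childView C i () | ⋃ᴸ | tagT , k | false
  childView C i eq | ⋂ᴸ | tagT , k with tree (codeᴿ C) [ k ] in k∈
  childView C i refl | ⋂ᴸ | tagT , k | true = original k k∈
  childView C i () | ⋂ᴸ | tagT , k | false
  childView C i eq | ⋃ᴸ | tagP , k with 𝒫 k in P∈
  childView C i () | ⋃ᴸ | tagP , k | nothing
  childView C i eq | ⋃ᴸ | tagP , k | just P with rankᴿ 𝒪 P <*? rankᴿ 𝒪 C
  childView C i refl | ⋃ᴸ | tagP , k | just P | yes P<C = positive ℓ≡ (k , P∈) P<C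
  childView C i () | ⋃ᴸ | tagP , k | just P | no _
  childView C i () | ⋂ᴸ | tagP , k
  childView C i () | ⋃ᴸ | tagN , k
  childView C i eq | ⋂ᴸ | tagN , k with 𝒩 k in N∈
  childView C i () | ⋂ᴸ | tagN , k | nothing
  childView C i eq | ⋂ᴸ | tagN , k | just N with rankᴿ 𝒪 N <*? rankᴿ 𝒪 C
  childView C i refl | ⋂ᴸ | tagN , k | just N | yes N<C = negative ℓ≡ (k , N∈) N<C
  childView C i () | ⋂ᴸ | tagN , k | just N | no _

  originalIndex : ℕ → ℕ
  originalIndex zero    = zero
  originalIndex (suc k) = suc (suc (suc (originalIndex k)))

  decode3-originalIndex : ∀ k → decode3 𝒪 (originalIndex k) ≡ (tagT , k)
  decode3-originalIndex zero = refl
  decode3-originalIndex (suc k) rewrite decode3-originalIndex k = refl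

  child-original : ∀ C k → label (codeᴿ C) [] ≡ ⋃ᴸ ⊎ label (codeᴿ C) [] ≡ ⋂ᴸ →
                   [ k ] ∈ᵀ codeᴿ C → child C (originalIndex k) ≡ just (subᴿ 𝒪 C k)
  child-original C k isNode k∈
    with label (codeᴿ C) [] | decode3 𝒪 (originalIndex k) | decode3-originalIndex k
  child-original C k (inj₁ refl) k∈ | ⋃ᴸ | _ | refl with tree (codeᴿ C) [ k ]
  child-original C k (inj₁ refl) refl | ⋃ᴸ | _ | refl | true = refl
  child-original C k (inj₂ refl) k∈ | ⋂ᴸ | _ | refl with tree (codeᴿ C) [ k ]
  child-original C k (inj₂ refl) refl | ⋂ᴸ | _ | refl | true = refl

  nav-∷ : ∀ C i σ → nav 𝒪 𝒫 𝒩 C (i ∷ σ) ≡ (child C i >>= λ D → nav 𝒪 𝒫 𝒩 D σ)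
  nav-∷ C i σ with child C i
  ... | just D  = refl
  ... | nothing = refl

  decorate-child : ∀ C i {D} → child C i ≡ just D → subᵀ (decorate C) i ≈ᵀ decorate D
  decorate-child C i eq =
    (λ σ → cong is-just (nav≡ σ)) , (λ σ → cong (labelAt 𝒪 𝒫 𝒩) (nav≡ σ))
    where
    nav≡ : ∀ σ → nav 𝒪 𝒫 𝒩 C (i ∷ σ) ≡ nav 𝒪 𝒫 𝒩 _ σ
    nav≡ σ = trans (nav-∷ C i σ) (cong (_>>= λ D → nav 𝒪 𝒫 𝒩 D σ) eq)

  decorate-absent : ∀ C i → child C i ≡ nothing → ∀ σ → tree (subᵀ (decorate C) i) σ ≡ false
  decorate-absent C i eq σ =
    cong is-just (trans (nav-∷ C i σ) (cong (_>>= λ D → nav 𝒪 𝒫 𝒩 D σ) eq))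

  decorate-child∈ : ∀ C i {D} → child C i ≡ just D → [ i ] ∈ᵀ decorate C
  decorate-child∈ C i eq = proj₁ (decorate-child C i eq) []

  decorate-child-exists : ∀ C i → [ i ] ∈ᵀ decorate C → ∃[ D ] child C i ≡ just D
  decorate-child-exists C i i∈ = present (child C i) refl
    where
    present : ∀ m → child C i ≡ m → ∃[ D ] child C i ≡ just D
    present (just D) eq = D , eq
    present nothing  eq = ⊥-elim (true≢false (trans (sym i∈) (decorate-absent C i eq [])))

module Correctness
  (lem : ExcludedMiddle 0ℓ) (𝒪 : NotationSystem) (α : NotationSystem.Not 𝒪) (𝒫 𝒩 : CSet 𝒪)
  (ranked : ∀ Q → (_∈ˢ_ 𝒪 Q 𝒫 ⊎ _∈ˢ_ 𝒪 Q 𝒩) → IsRankedCode 𝒪 α Q)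
  (X : Cantor)
  (avoids : ∀ Q → (_∈ˢ_ 𝒪 Q 𝒫 ⊎ _∈ˢ_ 𝒪 Q 𝒩) → NotationSystem._<*_ 𝒪 (rankᴿ 𝒪 Q) α →
            ¬ (X ∈⟦ codeᴿ Q ⟧))
  where
  open NotationSystem 𝒪
  open Ordinals 𝒪
  open RankedTrees 𝒪 α
  open Decoration 𝒪 𝒫 𝒩

  ChildView-ranked : ∀ {C D} → IsRankedTree C → ChildView C D →
                     IsRankedTree D × rankᴿ 𝒪 D <* rankᴿ 𝒪 C
  ChildView-ranked r (original k k∈)     = IsRankedTree-sub r k∈ , descending r [] k k∈
  ChildView-ranked r (positive _ P∈ P<C) = IsRankedCode⇒IsRankedTree (ranked _ (inj₁ P∈)) , P<C
  ChildView-ranked r (negative _ N∈ N<C) =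
    IsRankedTree-neg (IsRankedCode⇒IsRankedTree (ranked _ (inj₂ N∈))) , N<C

  decorate-wf : ∀ {C} → IsRankedTree C → Acc _<*_ (rankᴿ 𝒪 C) → WfTree (decorate C)
  decorate-wf {C} r (acc smaller) = node wf-child
    where
    wf-child : ∀ i → WfTree (subᵀ (decorate C) i)
    wf-child i with child C i in eq
    ... | nothing = empty (decorate-absent C i eq)
    ... | just D  =
      let (rD , D<C) = ChildView-ranked r (childView C i eq) in
      WfTree-resp-≈ᵀ (≈ᵀ-sym (decorate-child C i eq)) (decorate-wf rD (smaller D<C))

  ChildrenCorrect : RCode 𝒪 → Set
  ChildrenCorrect C = ∀ i {D} → child C i ≡ just D → X ∈⟦ subᵀ (decorate C) i ⟧ ⇔ X ∈⟦ codeᴿ D ⟧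

  module _ {C : RCode 𝒪} (r : IsRankedTree C) (accC : Acc _<*_ (rankᴿ 𝒪 C))
           (children-correct : ChildrenCorrect C) where

    union-agrees : label (codeᴿ C) [] ≡ ⋃ᴸ →
      (∃[ i ] ([ i ] ∈ᵀ decorate C × X ∈⟦ subᵀ (decorate C) i ⟧)) ⇔
      (∃[ k ] ([ k ] ∈ᵀ codeᴿ C × X ∈⟦ subᵀ (codeᴿ C) k ⟧))
    union-agrees isUnion = mk⇔ decorated⇒original original⇒decorated
      where
      decorated⇒original : ∃[ i ] ([ i ] ∈ᵀ decorate C × X ∈⟦ subᵀ (decorate C) i ⟧) →
                           ∃[ k ] ([ k ] ∈ᵀ codeᴿ C × X ∈⟦ subᵀ (codeᴿ C) k ⟧)
      decorated⇒original (i , i∈ , X∈) with decorate-child-exists C i i∈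
      ... | D , eq with childView C i eq
      ...   | original k k∈ = k , k∈ , to (children-correct i eq) X∈
      ...   | positive _ P∈ P<C =
        ⊥-elim (avoids _ (inj₁ P∈) (<*-≤*-trans P<C (rank≤α r)) (to (children-correct i eq) X∈))
      ...   | negative isInter _ _ = ⊥-elim (⋃≢⋂ (trans (sym isUnion) isInter))
      original⇒decorated : ∃[ k ] ([ k ] ∈ᵀ codeᴿ C × X ∈⟦ subᵀ (codeᴿ C) k ⟧) →
                           ∃[ i ] ([ i ] ∈ᵀ decorate C × X ∈⟦ subᵀ (decorate C) i ⟧)
      original⇒decorated (k , k∈ , X∈) =
        let eq = child-original C k (inj₁ isUnion) k∈ in
        originalIndex k , decorate-child∈ C (originalIndex k) eq ,
        from (children-correct (originalIndex k) eq) X∈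

    intersection-agrees : label (codeᴿ C) [] ≡ ⋂ᴸ →
      (∀ i → [ i ] ∈ᵀ decorate C → X ∈⟦ subᵀ (decorate C) i ⟧) ⇔
      (∀ k → [ k ] ∈ᵀ codeᴿ C → X ∈⟦ subᵀ (codeᴿ C) k ⟧)
    intersection-agrees isInter = mk⇔ decorated⇒original original⇒decorated
      where
      decorated⇒original : (∀ i → [ i ] ∈ᵀ decorate C → X ∈⟦ subᵀ (decorate C) i ⟧) →
                           ∀ k → [ k ] ∈ᵀ codeᴿ C → X ∈⟦ subᵀ (codeᴿ C) k ⟧
      decorated⇒original all k k∈ =
        let eq = child-original C k (inj₂ isInter) k∈ in
        to (children-correct (originalIndex k) eq) (all _ (decorate-child∈ C (originalIndex k) eq))
      original⇒decorated : (∀ k → [ k ] ∈ᵀ codeᴿ C → X ∈⟦ subᵀ (codeᴿ C) k ⟧) →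
                           ∀ i → [ i ] ∈ᵀ decorate C → X ∈⟦ subᵀ (decorate C) i ⟧
      original⇒decorated all i i∈ with decorate-child-exists C i i∈
      ... | D , eq with childView C i eq
      ...   | original k k∈ = from (children-correct i eq) (all k k∈)
      ...   | positive isUnion _ _ = ⊥-elim (⋃≢⋂ (trans (sym isUnion) isInter))
      ...   | negative _ N∈ N<C =
        let rN = IsRankedCode⇒IsRankedTree (ranked _ (inj₂ N∈)) in
        from (children-correct i eq)
          (∉⇒∈⟦neg⟧ lem (IsRankedTree⇒WfTree rN (acc-inverse accC N<C))
                    (avoids _ (inj₂ N∈) (<*-≤*-trans N<C (rank≤α r))))

    RootCondition-agrees : RootCondition X (decorate C) ⇔ RootCondition X (codeᴿ C)
    RootCondition-agrees = by-label (label (codeᴿ C) []) refl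
      where
      by-label : ∀ ℓ → label (codeᴿ C) [] ≡ ℓ →
        NodeCondition ℓ X (λ i → [ i ] ∈ᵀ decorate C) (λ i → X ∈⟦ subᵀ (decorate C) i ⟧) ⇔
        NodeCondition ℓ X (λ k → [ k ] ∈ᵀ codeᴿ C) (λ k → X ∈⟦ subᵀ (codeᴿ C) k ⟧)
      by-label (leafᴸ c) _       = ⇔.refl
      by-label ⋃ᴸ        isUnion = union-agrees isUnion
      by-label ⋂ᴸ        isInter = intersection-agrees isInter

  decorate-correct : ∀ C → IsRankedTree C → Acc _<*_ (rankᴿ 𝒪 C) →
                     X ∈⟦ decorate C ⟧ ⇔ X ∈⟦ codeᴿ C ⟧
  decorate-correct C r accC@(acc smaller) =
    ⇔.trans (∈⟦⟧⇔RootCondition lem (decorate-wf r accC) refl)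
   (⇔.trans (RootCondition-agrees r accC children-correct)
            (⇔.sym (∈⟦⟧⇔RootCondition lem (IsRankedTree⇒WfTree r accC) (root∈ r))))
    where
    children-correct : ChildrenCorrect C
    children-correct i eq =
      let (rD , D<C) = ChildView-ranked r (childView C i eq) in
      ⇔.trans (∈⟦⟧-resp-≈ᵀ (decorate-child C i eq)) (decorate-correct _ rD (smaller D<C))

open NotationSystem

lemma3p2 : ExcludedMiddle 0ℓ →
    (𝒪 : NotationSystem) (α : Not 𝒪) → InO 𝒪 α →
    (𝒫 𝒩 : CSet 𝒪) →
    (∀ Q → (_∈ˢ_ 𝒪 Q 𝒫 ⊎ _∈ˢ_ 𝒪 Q 𝒩) → IsRankedCode 𝒪 α Q) →
    (T : RCode 𝒪) → IsRankedCode 𝒪 α T →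
    (X : Cantor) →
    (∀ Q → (_∈ˢ_ 𝒪 Q 𝒫 ⊎ _∈ˢ_ 𝒪 Q 𝒩) → _<*_ 𝒪 (rankᴿ 𝒪 Q) α → ¬ (X ∈⟦ codeᴿ Q ⟧)) →
    (X ∈⟦ Decorate 𝒪 𝒫 𝒩 T ⟧ ⇔ X ∈⟦ codeᴿ T ⟧)
lemma3p2 lem 𝒪 α α∈O 𝒫 𝒩 ranked T T-ranked X avoids =
  decorate-correct T r (Acc-≤* (InO⇒Acc lem α∈O) (rank≤α r))
  where
  open Ordinals 𝒪
  open RankedTrees 𝒪 α
  open Correctness lem 𝒪 α 𝒫 𝒩 ranked X avoids
  r : IsRankedTree T
  r = IsRankedCode⇒IsRankedTree T-ranked
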